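{- For integers $1\leq k\leq n$, \[|\mathcal{I}^{(n)}_{p_k}(P_n^*)|=F(k-1)\,F(n-k).\]
   Context: $P_n$ is the path graph with vertices $x_1,\dots,x_n$ and edges $x_jx_{j+1}$ ($1\leq j\leq n-1$), and the pendant graph $P_n^*$ has vertex set $\{x_1,\dots,x_n\}\sqcup\{p_1,\dots,p_n\}$ and edge set $E(P_n)\sqcup\{x_1p_1,\dots,x_np_n\}$. $\mathcal{I}^{(n)}_v(H)$ is the family of independent sets of size $n$ in a graph $H$ containing the vertex $v$. The shifted Fibonacci sequence is defined by $F(0)=1$, $F(1)=2$, and $F(m)=F(m-1)+F(m-2)$ for $m\geq 2$. -}

module Defs where

open import Data.Nat using (ℕ; zero; suc; _+_)
open import Data.Bool using (Bool; true; false; _∧_; not; if_then_else_)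
open import Data.Fin using (Fin; zero; suc)
open import Data.Vec using (Vec; []; _∷_; lookup)
open import Data.List using (List; []; _∷_; map; _++_; length; filterᵇ; concatMap)
open import Data.Product using (_×_; _,_; proj₁; proj₂)
open import Data.Sum using (_⊎_; inj₁; inj₂)

F : ℕ → ℕ
F zero = 1
F (suc zero) = 2
F (suc (suc m)) = F (suc m) + F m

-- Vertices of the pendant graph P_n^* :
--   inj₁ i  is  x_{i+1},   inj₂ i  is  p_{i+1}   (i : Fin n, 0-based).
Vertex : ℕ → Set
Vertex n = Fin n ⊎ Fin n

x : ∀ {n} → Fin n → Vertex n
x = inj₁

p : ∀ {n} → Fin n → Vertex n
p = inj₂

pathEdges : (n : ℕ) → List (Fin n × Fin n)
pathEdges zero = []
pathEdges (suc zero) = []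
pathEdges (suc (suc n)) =
  (zero , suc zero) ∷ map (λ e → suc (proj₁ e) , suc (proj₂ e)) (pathEdges (suc n))

allFin : (n : ℕ) → List (Fin n)
allFin zero = []
allFin (suc n) = zero ∷ map suc (allFin n)

pendantEdges : (n : ℕ) → List (Vertex n × Vertex n)
pendantEdges n =
  map (λ e → x (proj₁ e) , x (proj₂ e)) (pathEdges n)
  ++ map (λ i → x i , p i) (allFin n)

-- A set of vertices of P_n^*, given by characteristic vectors
-- (first component: the x's, second component: the p's).
VSet : ℕ → Set
VSet n = Vec Bool n × Vec Bool n

_∈ᵇ_ : ∀ {n} → Vertex n → VSet n → Bool
inj₁ i ∈ᵇ S = lookup (proj₁ S) i
inj₂ i ∈ᵇ S = lookup (proj₂ S) i

countTrue : ∀ {n} → Vec Bool n → ℕ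
countTrue [] = 0
countTrue (b ∷ v) = (if b then 1 else 0) + countTrue v

size : ∀ {n} → VSet n → ℕ
size S = countTrue (proj₁ S) + countTrue (proj₂ S)

allᵇ : {A : Set} → (A → Bool) → List A → Bool
allᵇ f [] = true
allᵇ f (a ∷ as) = f a ∧ allᵇ f as

independent : ∀ {n} → VSet n → Bool
independent {n} S =
  allᵇ (λ e → not ((proj₁ e ∈ᵇ S) ∧ (proj₂ e ∈ᵇ S))) (pendantEdges n)

allVecs : (n : ℕ) → List (Vec Bool n)
allVecs zero = [] ∷ []
allVecs (suc n) = map (true ∷_) (allVecs n) ++ map (false ∷_) (allVecs n)

allVSets : (n : ℕ) → List (VSet n)
allVSets n = concatMap (λ a → map (λ b → a , b) (allVecs n)) (allVecs n)

_==_ : ℕ → ℕ → Bool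
zero == zero = true
suc a == suc b = a == b
_ == _ = false

ℐ : (n m : ℕ) → Vertex n → List (VSet n)
ℐ n m v = filterᵇ (λ S → independent S ∧ (size S == m) ∧ (v ∈ᵇ S)) (allVSets n)

-- A size-n independent set of P_n^* meets each pendant edge x_i p_i exactly once, so it is
-- determined by its trace on the path, an independent set of P_n; it contains p_k exactly
-- when that trace avoids x_k. The independent sets of P_n avoiding x_k are counted by a
-- left-to-right scan remembering whether the previous vertex was taken: the first k - 1
-- vertices contribute F (k - 1) and the remaining n - k vertices F (n - k).
module Submission where

open import Defs
open import Data.Nat using (ℕ; zero; suc; _+_; _*_; _∸_; _≤_; z≤n; s≤s)
open import Data.Nat.Properties using (0∸n≡0; +-suc; +-comm; +-identityʳ; *-distribʳ-+; m≤n⇒m≤1+n)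
open import Data.Nat.ListAction using (sum)
open import Data.Nat.ListAction.Properties using (sum-++)
open import Data.Fin using (Fin; toℕ; zero; suc)
open import Data.Bool using (Bool; true; false; _∧_; _xor_; not; if_then_else_)
open import Data.Bool.Properties using (∧-assoc; ∧-comm; ∧-zeroʳ; ∧-identityʳ)
open import Data.Vec using (Vec; []; _∷_; lookup)
import Data.Vec as Vec
open import Data.Vec.Properties using (lookup-map)
open import Data.List using (List; []; _∷_; length; map; _++_; filterᵇ; concatMap)
open import Data.List.Properties using (map-++; map-∘)
open import Data.Product using (_,_; proj₁; proj₂)
open import Function using (_∘_)
open import Relation.Binary.PropositionalEquality
  using (_≡_; refl; sym; trans; cong; cong₂; module ≡-Reasoning)

open ≡-Reasoning

𝟙 : Bool → ℕ
𝟙 b = if b then 1 else 0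

∑ : (n : ℕ) → (Vec Bool n → ℕ) → ℕ
∑ zero    f = f []
∑ (suc n) f = ∑ n (f ∘ (true ∷_)) + ∑ n (f ∘ (false ∷_))

∑-cong : ∀ n {f g : Vec Bool n → ℕ} → (∀ a → f a ≡ g a) → ∑ n f ≡ ∑ n g
∑-cong zero    f≗g = f≗g []
∑-cong (suc n) f≗g = cong₂ _+_ (∑-cong n (f≗g ∘ (true ∷_))) (∑-cong n (f≗g ∘ (false ∷_)))

∑-zero : ∀ n {f : Vec Bool n → ℕ} → (∀ a → f a ≡ 0) → ∑ n f ≡ 0
∑-zero zero    f≗0 = f≗0 []
∑-zero (suc n) f≗0 = cong₂ _+_ (∑-zero n (f≗0 ∘ (true ∷_))) (∑-zero n (f≗0 ∘ (false ∷_)))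

∑-forced-false : ∀ n (f : Vec Bool (suc n) → ℕ) → (∀ a → f (true ∷ a) ≡ 0) →
  ∑ (suc n) f ≡ ∑ n (f ∘ (false ∷_))
∑-forced-false n f f≗0 = cong (_+ ∑ n (f ∘ (false ∷_))) (∑-zero n f≗0)

∑-forced-true : ∀ n (f : Vec Bool (suc n) → ℕ) → (∀ a → f (false ∷ a) ≡ 0) →
  ∑ (suc n) f ≡ ∑ n (f ∘ (true ∷_))
∑-forced-true n f f≗0 = trans (cong (∑ n (f ∘ (true ∷_)) +_) (∑-zero n f≗0)) (+-identityʳ _)

length-filterᵇ : {A : Set} (P : A → Bool) (xs : List A) →
  length (filterᵇ P xs) ≡ sum (map (𝟙 ∘ P) xs)
length-filterᵇ P [] = refl
length-filterᵇ P (a ∷ xs) with P a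
... | true  = cong suc (length-filterᵇ P xs)
... | false = length-filterᵇ P xs

sum-map-concatMap : {A B : Set} (f : B → ℕ) (g : A → List B) (xs : List A) →
  sum (map f (concatMap g xs)) ≡ sum (map (sum ∘ map f ∘ g) xs)
sum-map-concatMap f g [] = refl
sum-map-concatMap f g (a ∷ xs) = begin
  sum (map f (g a ++ concatMap g xs))               ≡⟨ cong sum (map-++ f (g a) _) ⟩
  sum (map f (g a) ++ map f (concatMap g xs))       ≡⟨ sum-++ (map f (g a)) _ ⟩
  sum (map f (g a)) + sum (map f (concatMap g xs))  ≡⟨ cong (_ +_) (sum-map-concatMap f g xs) ⟩
  sum (map f (g a)) + sum (map (sum ∘ map f ∘ g) xs) ∎

sum-map-allVecs : ∀ n (f : Vec Bool n → ℕ) → sum (map f (allVecs n)) ≡ ∑ n f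
sum-map-allVecs zero    f = +-identityʳ (f [])
sum-map-allVecs (suc n) f = begin
  sum (map f (map (true ∷_) vs ++ map (false ∷_) vs))
    ≡⟨ cong sum (map-++ f (map (true ∷_) vs) _) ⟩
  sum (map f (map (true ∷_) vs) ++ map f (map (false ∷_) vs))
    ≡⟨ sum-++ (map f (map (true ∷_) vs)) _ ⟩
  sum (map f (map (true ∷_) vs)) + sum (map f (map (false ∷_) vs))
    ≡⟨ sym (cong₂ _+_ (cong sum (map-∘ vs)) (cong sum (map-∘ vs))) ⟩
  sum (map (f ∘ (true ∷_)) vs) + sum (map (f ∘ (false ∷_)) vs)
    ≡⟨ cong₂ _+_ (sum-map-allVecs n _) (sum-map-allVecs n _) ⟩
  ∑ n (f ∘ (true ∷_)) + ∑ n (f ∘ (false ∷_)) ∎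
  where vs = allVecs n

length-filterᵇ-allVSets : ∀ n (P : VSet n → Bool) →
  length (filterᵇ P (allVSets n)) ≡ ∑ n (λ a → ∑ n (λ b → 𝟙 (P (a , b))))
length-filterᵇ-allVSets n P = begin
  length (filterᵇ P (allVSets n))
    ≡⟨ length-filterᵇ P (allVSets n) ⟩
  sum (map (𝟙 ∘ P) (concatMap pairsWith (allVecs n)))
    ≡⟨ sum-map-concatMap (𝟙 ∘ P) pairsWith (allVecs n) ⟩
  sum (map (sum ∘ map (𝟙 ∘ P) ∘ pairsWith) (allVecs n))
    ≡⟨ sum-map-allVecs n _ ⟩
  ∑ n (sum ∘ map (𝟙 ∘ P) ∘ pairsWith)
    ≡⟨ ∑-cong n (λ a → trans (cong sum (sym (map-∘ (allVecs n)))) (sum-map-allVecs n _)) ⟩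
  ∑ n (λ a → ∑ n (λ b → 𝟙 (P (a , b)))) ∎
  where
  pairsWith : Vec Bool n → List (VSet n)
  pairsWith a = map (a ,_) (allVecs n)

-- The extra argument records whether the vertex preceding the vector is in the set.
pathIndependentAfter : ∀ {n} → Bool → Vec Bool n → Bool
pathIndependentAfter s []      = true
pathIndependentAfter s (c ∷ a) = not (s ∧ c) ∧ pathIndependentAfter c a

pathIndependent : ∀ {n} → Vec Bool n → Bool
pathIndependent = pathIndependentAfter false

disjoint : ∀ {n} → Vec Bool n → Vec Bool n → Bool
disjoint []       []       = true
disjoint (a ∷ as) (b ∷ bs) = not (a ∧ b) ∧ disjoint as bs

complementary : ∀ {n} → Vec Bool n → Vec Bool n → Bool
complementary []       []       = true
complementary (a ∷ as) (b ∷ bs) = (a xor b) ∧ complementary as bs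

allᵇ-++ : {A : Set} (f : A → Bool) (xs ys : List A) → allᵇ f (xs ++ ys) ≡ allᵇ f xs ∧ allᵇ f ys
allᵇ-++ f []       ys = refl
allᵇ-++ f (a ∷ xs) ys = trans (cong (f a ∧_) (allᵇ-++ f xs ys)) (sym (∧-assoc (f a) _ _))

allᵇ-map : {A B : Set} (f : B → Bool) (g : A → B) (xs : List A) → allᵇ f (map g xs) ≡ allᵇ (f ∘ g) xs
allᵇ-map f g []       = refl
allᵇ-map f g (a ∷ xs) = cong (f (g a) ∧_) (allᵇ-map f g xs)

allᵇ-pathEdges : ∀ n (a : Vec Bool n) →
  allᵇ (λ e → not (lookup a (proj₁ e) ∧ lookup a (proj₂ e))) (pathEdges n) ≡ pathIndependent a
allᵇ-pathEdges zero          []             = refl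
allᵇ-pathEdges (suc zero)    (c ∷ [])       = refl
allᵇ-pathEdges (suc (suc n)) (c₀ ∷ c₁ ∷ a) = cong (not (c₀ ∧ c₁) ∧_)
  (trans (allᵇ-map _ _ (pathEdges (suc n))) (allᵇ-pathEdges (suc n) (c₁ ∷ a)))

allᵇ-pendantEdges : ∀ n (a b : Vec Bool n) →
  allᵇ (λ i → not (lookup a i ∧ lookup b i)) (allFin n) ≡ disjoint a b
allᵇ-pendantEdges zero    []       []       = refl
allᵇ-pendantEdges (suc n) (a₀ ∷ a) (b₀ ∷ b) = cong (not (a₀ ∧ b₀) ∧_)
  (trans (allᵇ-map _ suc (allFin n)) (allᵇ-pendantEdges n a b))

independent≡pathIndependent∧disjoint : ∀ {n} (a b : Vec Bool n) →
  independent (a , b) ≡ pathIndependent a ∧ disjoint a b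
independent≡pathIndependent∧disjoint {n} a b =
  trans (allᵇ-++ _ (map (λ e → x (proj₁ e) , x (proj₂ e)) (pathEdges n)) (map (λ i → x i , p i) (allFin n)))
        (cong₂ _∧_ (trans (allᵇ-map _ _ (pathEdges n)) (allᵇ-pathEdges n a))
                   (trans (allᵇ-map _ _ (allFin n)) (allᵇ-pendantEdges n a b)))

disjoint⇒size≤ : ∀ {n} (a b : Vec Bool n) → disjoint a b ≡ true → size (a , b) ≤ n
disjoint⇒size≤ []          []          _  = z≤n
disjoint⇒size≤ (true ∷ a)  (false ∷ b) ab = s≤s (disjoint⇒size≤ a b ab)
disjoint⇒size≤ (false ∷ a) (true ∷ b)  ab
  rewrite +-suc (countTrue a) (countTrue b) = s≤s (disjoint⇒size≤ a b ab)
disjoint⇒size≤ (false ∷ a) (false ∷ b) ab = m≤n⇒m≤1+n (disjoint⇒size≤ a b ab)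

≤⇒==suc≡false : ∀ {m n} → m ≤ n → (m == suc n) ≡ false
≤⇒==suc≡false z≤n      = refl
≤⇒==suc≡false (s≤s le) = ≤⇒==suc≡false le

-- Disjointness means each pendant edge is hit at most once; size n forces exactly once.
disjoint∧full≡complementary : ∀ {n} (a b : Vec Bool n) →
  disjoint a b ∧ (size (a , b) == n) ≡ complementary a b
disjoint∧full≡complementary []          []          = refl
disjoint∧full≡complementary (true ∷ a)  (true ∷ b)  = refl
disjoint∧full≡complementary (true ∷ a)  (false ∷ b) = disjoint∧full≡complementary a b
disjoint∧full≡complementary (false ∷ a) (true ∷ b)
  rewrite +-suc (countTrue a) (countTrue b) = disjoint∧full≡complementary a b
disjoint∧full≡complementary (false ∷ a) (false ∷ b) with disjoint a b in ab
... | true  = ≤⇒==suc≡false (disjoint⇒size≤ a b ab)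
... | false = refl

independent∧full≡complementary∧pathIndependent : ∀ {n} (a b : Vec Bool n) →
  independent (a , b) ∧ (size (a , b) == n) ≡ complementary a b ∧ pathIndependent a
independent∧full≡complementary∧pathIndependent {n} a b = begin
  independent (a , b) ∧ full
    ≡⟨ cong (_∧ full) (independent≡pathIndependent∧disjoint a b) ⟩
  (pathIndependent a ∧ disjoint a b) ∧ full
    ≡⟨ ∧-assoc (pathIndependent a) (disjoint a b) full ⟩
  pathIndependent a ∧ (disjoint a b ∧ full)
    ≡⟨ cong (pathIndependent a ∧_) (disjoint∧full≡complementary a b) ⟩
  pathIndependent a ∧ complementary a b
    ≡⟨ ∧-comm (pathIndependent a) (complementary a b) ⟩
  complementary a b ∧ pathIndependent a ∎
  where full = size (a , b) == n

∑-complementary : ∀ n (a : Vec Bool n) (R : Vec Bool n → Bool) →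
  ∑ n (λ b → 𝟙 (complementary a b ∧ R b)) ≡ 𝟙 (R (Vec.map not a))
∑-complementary zero    []         R = refl
∑-complementary (suc n) (true ∷ a)  R =
  trans (∑-forced-false n (λ b → 𝟙 (complementary (true ∷ a) b ∧ R b)) (λ _ → refl))
        (∑-complementary n a (R ∘ (false ∷_)))
∑-complementary (suc n) (false ∷ a) R =
  trans (∑-forced-true n (λ b → 𝟙 (complementary (false ∷ a) b ∧ R b)) (λ _ → refl))
        (∑-complementary n a (R ∘ (true ∷_)))

F-pred+F : ∀ m → F (m ∸ 1) + F m ≡ F (suc m)
F-pred+F zero    = refl
F-pred+F (suc m) = +-comm (F m) (F (suc m))

-- For s = true and n = 0 the truncated subtraction yields F 0 = 1, the count for the empty path.
∑-pathIndependentAfter : ∀ n s → ∑ n (𝟙 ∘ pathIndependentAfter s) ≡ F (n ∸ 𝟙 s)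
∑-pathIndependentAfter zero    false = refl
∑-pathIndependentAfter zero    true  = refl
∑-pathIndependentAfter (suc n) false =
  trans (cong₂ _+_ (∑-pathIndependentAfter n true) (∑-pathIndependentAfter n false)) (F-pred+F n)
∑-pathIndependentAfter (suc n) true  =
  trans (∑-forced-false n (𝟙 ∘ pathIndependentAfter true) (λ _ → refl)) (∑-pathIndependentAfter n false)

∑-pathIndependentAfter-avoiding : ∀ n s (k : Fin n) →
  ∑ n (λ a → 𝟙 (pathIndependentAfter s a ∧ not (lookup a k))) ≡ F (toℕ k ∸ 𝟙 s) * F (n ∸ suc (toℕ k))
∑-pathIndependentAfter-avoiding (suc n) s zero = begin
  ∑ n (λ a → 𝟙 ((not (s ∧ true) ∧ pathIndependentAfter true a) ∧ false))
    + ∑ n (λ a → 𝟙 ((not (s ∧ false) ∧ pathIndependentAfter false a) ∧ true))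
    ≡⟨ cong₂ _+_ (∑-zero n (λ a → cong 𝟙 (∧-zeroʳ _)))
                 (∑-cong n (λ a → cong 𝟙 (trans (∧-identityʳ _) (cong (λ t → not t ∧ _) (∧-zeroʳ s))))) ⟩
  ∑ n (𝟙 ∘ pathIndependentAfter false)  ≡⟨ ∑-pathIndependentAfter n false ⟩
  F n                                   ≡⟨ sym (+-identityʳ (F n)) ⟩
  1 * F n                               ≡⟨ cong (_* F n) (cong F (sym (0∸n≡0 (𝟙 s)))) ⟩
  F (0 ∸ 𝟙 s) * F n                     ∎
∑-pathIndependentAfter-avoiding (suc n) false (suc k) = begin
  ∑ n (avoiding true) + ∑ n (avoiding false)
    ≡⟨ cong₂ _+_ (∑-pathIndependentAfter-avoiding n true k) (∑-pathIndependentAfter-avoiding n false k) ⟩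
  F (toℕ k ∸ 1) * G + F (toℕ k) * G
    ≡⟨ sym (*-distribʳ-+ G (F (toℕ k ∸ 1)) (F (toℕ k))) ⟩
  (F (toℕ k ∸ 1) + F (toℕ k)) * G
    ≡⟨ cong (_* G) (F-pred+F (toℕ k)) ⟩
  F (suc (toℕ k)) * G ∎
  where
  G = F (n ∸ suc (toℕ k))
  avoiding : Bool → Vec Bool n → ℕ
  avoiding s a = 𝟙 (pathIndependentAfter s a ∧ not (lookup a k))
∑-pathIndependentAfter-avoiding (suc n) true  (suc k) =
  trans (∑-forced-false n (λ a → 𝟙 (pathIndependentAfter true a ∧ not (lookup a (suc k)))) (λ _ → refl))
        (∑-pathIndependentAfter-avoiding n false k)

lemma7 : (n : ℕ) (k : Fin n) →
    length (ℐ n n (p k)) ≡ F (toℕ k) * F (n ∸ suc (toℕ k))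
lemma7 n k = begin
  length (ℐ n n (p k))
    ≡⟨ length-filterᵇ-allVSets n _ ⟩
  ∑ n (λ a → ∑ n (λ b → 𝟙 (independent (a , b) ∧ (size (a , b) == n) ∧ lookup b k)))
    ≡⟨ ∑-cong n (λ a → ∑-cong n (λ b → cong 𝟙 (reassociate a b))) ⟩
  ∑ n (λ a → ∑ n (λ b → 𝟙 (complementary a b ∧ (pathIndependent a ∧ lookup b k))))
    ≡⟨ ∑-cong n (λ a → ∑-complementary n a (λ b → pathIndependent a ∧ lookup b k)) ⟩
  ∑ n (λ a → 𝟙 (pathIndependent a ∧ lookup (Vec.map not a) k))
    ≡⟨ ∑-cong n (λ a → cong (λ c → 𝟙 (pathIndependent a ∧ c)) (lookup-map k not a)) ⟩
  ∑ n (λ a → 𝟙 (pathIndependent a ∧ not (lookup a k)))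
    ≡⟨ ∑-pathIndependentAfter-avoiding n false k ⟩
  F (toℕ k) * F (n ∸ suc (toℕ k)) ∎
  where
  reassociate : ∀ a b → independent (a , b) ∧ (size (a , b) == n) ∧ lookup b k
                        ≡ complementary a b ∧ (pathIndependent a ∧ lookup b k)
  reassociate a b = begin
    independent (a , b) ∧ (size (a , b) == n) ∧ lookup b k
      ≡⟨ sym (∧-assoc (independent (a , b)) _ _) ⟩
    (independent (a , b) ∧ (size (a , b) == n)) ∧ lookup b k
      ≡⟨ cong (_∧ lookup b k) (independent∧full≡complementary∧pathIndependent a b) ⟩
    (complementary a b ∧ pathIndependent a) ∧ lookup b k
      ≡⟨ ∧-assoc (complementary a b) _ _ ⟩
    complementary a b ∧ (pathIndependent a ∧ lookup b k) ∎
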